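{- Let $n\geq 2$, let $k$ be an integer with $1\leq k\leq n-1$, and let $J=\{j_1,\dots,j_k\}$ with $2\leq j_1<j_2<\cdots<j_k\leq n$. Then the subgraphs of the augmented cube $AQ_n$ induced by the edge sets $$\bigcup_{i\in\{1,\dots,n\}\setminus J}E_i\ \cup\ \bigcup_{j\in J}E_{\leq j} \qquad\text{and}\qquad E_1\ \cup\ \bigcup_{j\in J}E_j\ \cup\ \bigcup_{i\in\{2,\dots,n\}\setminus J}E_{\leq i}$$ are both isomorphic to the hypercube $Q_n$.
   Context: The hypercube $Q_n$ has vertex set $\{0,1\}^n$, two vertices adjacent iff they differ in exactly one bit. The augmented cube $AQ_n$ has vertex set $\{0,1\}^n$ (strings $x_n\cdots x_1$) and edge set $\left(\bigcup_{i=1}^n E_i\right)\cup\left(\bigcup_{j=2}^n E_{\leq j}\right)$, where $E_i=\{(x_n\cdots x_1,\ x_n\cdots x_{i+1}(x_i+1)x_{i-1}\cdots x_1)\}$ (hypercube edges of dimension $i$: flip bit $i$) and $E_{\leq j}=\{(x_n\cdots x_1,\ x_n\cdots x_{j+1}(x_j+1)\cdots(x_1+1))\}$ (augmented edges of dimension $j$: flip bits $1,\dots,j$), addition mod 2. The subgraph induced by an edge set $E$ has edge set $E$ and vertex set the ends of edges in $E$. -}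

module Defs where

open import Data.Bool using (Bool; not; if_then_else_)
open import Data.Nat using (ℕ; _≤ᵇ_)
open import Data.Fin using (Fin; toℕ)
open import Data.Fin.Subset using (Subset; _∈_; _∉_)
open import Data.Vec using (Vec; lookup; tabulate; updateAt)
open import Data.Product using (Σ; ∃; _×_)
open import Data.Sum using (_⊎_)
open import Relation.Binary.PropositionalEquality using (_≡_; _≢_)
open import Function.Bundles using (_⇔_)
open import Function.Definitions using (Injective)

-- A vertex x_n ⋯ x_1 ∈ {0,1}^n is a Vec Bool n; the bit x_d of dimension d
-- (1 ≤ d ≤ n) is stored at position i : Fin n with toℕ i + 1 = d.
Vertex : ℕ → Set
Vertex n = Vec Bool n

flipBit : ∀ {n} → Fin n → Vertex n → Vertex n
flipBit i x = updateAt x i not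

flipUpTo : ∀ {n} → Fin n → Vertex n → Vertex n
flipUpTo j x = tabulate (λ m → if toℕ m ≤ᵇ toℕ j then not (lookup x m) else lookup x m)

E : ∀ {n} → Fin n → Vertex n → Vertex n → Set
E i x y = y ≡ flipBit i x

E≤ : ∀ {n} → Fin n → Vertex n → Vertex n → Set
E≤ j x y = y ≡ flipUpTo j x

Qadj : ∀ {n} → Vertex n → Vertex n → Set
Qadj {n} u v = ∃ λ (i : Fin n) → v ≡ flipBit i u

EdgeSet : ℕ → Set₁
EdgeSet n = Vertex n → Vertex n → Set

-- The subgraph induced by an edge set R has edge set R and vertex set the
-- ends of edges of R.
record QnIsoToInduced (n : ℕ) (R : EdgeSet n) : Set where
  field
    f          : Vertex n → Vertex n
    injective  : Injective _≡_ _≡_ f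
    into-ends  : ∀ u → (∃ λ y → R (f u) y) ⊎ (∃ λ y → R y (f u))
    onto-ends₁ : ∀ x y → R x y → ∃ λ u → f u ≡ x
    onto-ends₂ : ∀ x y → R x y → ∃ λ u → f u ≡ y
    adjacency  : ∀ u v → Qadj u v ⇔ R (f u) (f v)

H₁ : ∀ {n} → Subset n → EdgeSet n
H₁ {n} J x y =
  (∃ λ (i : Fin n) → i ∉ J × E i x y) ⊎ (∃ λ (j : Fin n) → j ∈ J × E≤ j x y)

H₂ : ∀ {n} → Subset n → EdgeSet n
H₂ {n} J x y =
  (∃ λ (i : Fin n) → toℕ i ≡ 0 × E i x y)
  ⊎ (∃ λ (j : Fin n) → j ∈ J × E j x y)
  ⊎ (∃ λ (i : Fin n) → toℕ i ≢ 0 × i ∉ J × E≤ i x y)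

{-# OPTIONS --safe #-}
module Submission where

-- Both edge sets consist of the moves x ↦ flipWith c i x (one per dimension i),
-- where c chooses between E_i and E_{≤ i}; the corresponding vectors
-- g_i = flipWith c i 0 form a unitriangular, hence invertible, basis of 𝔽₂ⁿ.
-- The linear map sending the i-th unit vector to g_i therefore turns
-- "flip bit i" into "add g_i", an isomorphism from Q_n onto the induced graph.

open import Defs
open import Data.Nat using (ℕ; _≤_; _∸_; zero; suc; _≤ᵇ_; _<ᵇ_)
open import Data.Fin using (Fin; toℕ; zero; suc)
open import Data.Fin.Subset using (Subset; _∈_; ∣_∣)
open import Data.Fin.Subset.Properties using (_∈?_)
open import Data.Product using (_×_; _,_; ∃)
open import Data.Sum using (_⊎_; inj₁; inj₂)
open import Data.Bool using (Bool; true; false; not; _xor_; _∧_; if_then_else_)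
open import Data.Bool.Properties
  using (xor-assoc; xor-comm; xor-same; not-distribʳ-xor; ∧-distribˡ-xor; ∧-identityʳ)
open import Data.Vec using (_∷_; []; lookup; tabulate)
open import Data.Vec.Properties using (tabulate-cong; tabulate∘lookup)
open import Data.Empty using (⊥-elim)
open import Relation.Nullary using (does; yes; no)
open import Relation.Nullary.Decidable using (dec-true; dec-false)
open import Relation.Binary.PropositionalEquality
open import Function using (_∘_)
open import Function.Bundles using (_⇔_; mk⇔; Equivalence)
open import Function.Definitions using (Injective)

xor-cancelˡ : ∀ a b → a xor (a xor b) ≡ b
xor-cancelˡ a b = trans (sym (xor-assoc a a b)) (cong (_xor b) (xor-same a))

xor-swapˡ : ∀ a b c → a xor (b xor c) ≡ b xor (a xor c)
xor-swapˡ a b c = begin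
  a xor (b xor c)  ≡⟨ xor-assoc a b c ⟨
  (a xor b) xor c  ≡⟨ cong (_xor c) (xor-comm a b) ⟩
  (b xor a) xor c  ≡⟨ xor-assoc b a c ⟩
  b xor (a xor c)  ∎
  where open ≡-Reasoning

∧-not≡xor-∧ : ∀ a b → a ∧ not b ≡ a xor (a ∧ b)
∧-not≡xor-∧ a b = trans (∧-distribˡ-xor a true b) (cong (_xor (a ∧ b)) (∧-identityʳ a))

flipUpTo-zero : ∀ {n} x (w : Vertex n) → flipUpTo zero (x ∷ w) ≡ not x ∷ w
flipUpTo-zero x w = cong (not x ∷_) (tabulate∘lookup w)

flipUpTo-suc : ∀ {n} (j : Fin n) x (w : Vertex n) →
  flipUpTo (suc j) (x ∷ w) ≡ not x ∷ flipUpTo j w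
flipUpTo-suc j x w = cong (not x ∷_) (tabulate-cong λ m →
  cong (λ b → if b then not (lookup w m) else lookup w m) (<ᵇ-suc (toℕ m) (toℕ j)))
  where
  <ᵇ-suc : ∀ a b → (a <ᵇ suc b) ≡ (a ≤ᵇ b)
  <ᵇ-suc zero    b = refl
  <ᵇ-suc (suc a) b = refl

flipWith : ∀ {n} → (Fin n → Bool) → Fin n → Vertex n → Vertex n
flipWith c i x = if c i then flipUpTo i x else flipBit i x

MixedEdges : ∀ {n} → (Fin n → Bool) → EdgeSet n
MixedEdges {n} c x y = ∃ λ (i : Fin n) → y ≡ flipWith c i x

flipWith-false : ∀ {n} (c : Fin n → Bool) i x → c i ≡ false → flipWith c i x ≡ flipBit i x
flipWith-false c i x ci≡false rewrite ci≡false = refl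

flipWith-true : ∀ {n} (c : Fin n → Bool) i x → c i ≡ true → flipWith c i x ≡ flipUpTo i x
flipWith-true c i x ci≡true rewrite ci≡true = refl

flipWith-zero : ∀ {n} (c : Fin (suc n) → Bool) x (w : Vertex n) →
  flipWith c zero (x ∷ w) ≡ not x ∷ w
flipWith-zero c x w with c zero
... | true  = flipUpTo-zero x w
... | false = refl

flipWith-suc : ∀ {n} (c : Fin (suc n) → Bool) i x (w : Vertex n) →
  flipWith c (suc i) (x ∷ w) ≡ (c (suc i) xor x) ∷ flipWith (c ∘ suc) i w
flipWith-suc c i x w with c (suc i)
... | true  = flipUpTo-suc i x w
... | false = refl

parity : ∀ {n} → (Fin n → Bool) → Vertex n → Bool
parity c []      = false
parity c (b ∷ u) = (c zero ∧ b) xor parity (c ∘ suc) u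

-- Bit 0 of a generator g_i is set exactly when i = 0 or c i, so bit 0 of
-- ⊕ᵢ uᵢ gᵢ is u₀ xor the parity of the remaining bits weighted by c.
encode : ∀ {n} → (Fin n → Bool) → Vertex n → Vertex n
encode c []      = []
encode c (b ∷ u) = (parity (c ∘ suc) u xor b) ∷ encode (c ∘ suc) u

decode : ∀ {n} → (Fin n → Bool) → Vertex n → Vertex n
decode c []      = []
decode c (a ∷ w) = (parity (c ∘ suc) (decode (c ∘ suc) w) xor a) ∷ decode (c ∘ suc) w

encode∘decode : ∀ {n} (c : Fin n → Bool) w → encode c (decode c w) ≡ w
encode∘decode c []      = refl
encode∘decode c (a ∷ w) =
  cong₂ _∷_ (xor-cancelˡ (parity (c ∘ suc) (decode (c ∘ suc) w)) a) (encode∘decode (c ∘ suc) w)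

decode∘encode : ∀ {n} (c : Fin n → Bool) u → decode c (encode c u) ≡ u
decode∘encode c []      = refl
decode∘encode c (b ∷ u) rewrite decode∘encode (c ∘ suc) u =
  cong (_∷ u) (xor-cancelˡ (parity (c ∘ suc) u) b)

encode-injective : ∀ {n} (c : Fin n → Bool) → Injective _≡_ _≡_ (encode c)
encode-injective c {u} {v} eq = begin
  u                       ≡⟨ decode∘encode c u ⟨
  decode c (encode c u)   ≡⟨ cong (decode c) eq ⟩
  decode c (encode c v)   ≡⟨ decode∘encode c v ⟩
  v                       ∎
  where open ≡-Reasoning

parity-flipBit : ∀ {n} (c : Fin n → Bool) i u → parity c (flipBit i u) ≡ c i xor parity c u
parity-flipBit c zero (b ∷ u) = begin
  (c zero ∧ not b) xor p              ≡⟨ cong (_xor p) (∧-not≡xor-∧ (c zero) b) ⟩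
  (c zero xor (c zero ∧ b)) xor p     ≡⟨ xor-assoc (c zero) (c zero ∧ b) p ⟩
  c zero xor ((c zero ∧ b) xor p)     ∎
  where open ≡-Reasoning
        p : Bool
        p = parity (c ∘ suc) u
parity-flipBit c (suc i) (b ∷ u) rewrite parity-flipBit (c ∘ suc) i u =
  xor-swapˡ (c zero ∧ b) (c (suc i)) (parity (c ∘ suc) u)

encode-flipBit : ∀ {n} (c : Fin n → Bool) i u →
  encode c (flipBit i u) ≡ flipWith c i (encode c u)
encode-flipBit c zero (b ∷ u) = begin
  (p xor not b) ∷ encode (c ∘ suc) u        ≡⟨ cong (_∷ _) (not-distribʳ-xor p b) ⟨
  not (p xor b) ∷ encode (c ∘ suc) u        ≡⟨ flipWith-zero c (p xor b) _ ⟨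
  flipWith c zero (encode c (b ∷ u))        ∎
  where open ≡-Reasoning
        p : Bool
        p = parity (c ∘ suc) u
encode-flipBit c (suc i) (b ∷ u)
  rewrite parity-flipBit (c ∘ suc) i u | encode-flipBit (c ∘ suc) i u = begin
    ((c (suc i) xor p) xor b) ∷ flipWith (c ∘ suc) i (encode (c ∘ suc) u)
      ≡⟨ cong (_∷ _) (xor-assoc (c (suc i)) p b) ⟩
    (c (suc i) xor (p xor b)) ∷ flipWith (c ∘ suc) i (encode (c ∘ suc) u)
      ≡⟨ flipWith-suc c i (p xor b) _ ⟨
    flipWith c (suc i) (encode c (b ∷ u))
      ∎
  where open ≡-Reasoning
        p : Bool
        p = parity (c ∘ suc) u

MixedEdges-QnIso : ∀ {n} (c : Fin (suc n) → Bool) → QnIsoToInduced (suc n) (MixedEdges c)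
MixedEdges-QnIso c = record
  { f          = encode c
  ; injective  = encode-injective c
  ; into-ends  = λ u → inj₁ (flipWith c zero (encode c u) , zero , refl)
  ; onto-ends₁ = λ x _ _ → decode c x , encode∘decode c x
  ; onto-ends₂ = λ _ y _ → decode c y , encode∘decode c y
  ; adjacency  = λ u v → mk⇔
      (λ { (i , v≡) → i , trans (cong (encode c) v≡) (encode-flipBit c i u) })
      (λ { (i , ev≡) → i , encode-injective c (trans ev≡ (sym (encode-flipBit c i u))) })
  }

QnIsoToInduced-resp-⇔ : ∀ {n} {R R′ : EdgeSet n} → (∀ x y → R x y ⇔ R′ x y) →
  QnIsoToInduced n R → QnIsoToInduced n R′
QnIsoToInduced-resp-⇔ {R = R} {R′} R⇔R′ iso = record
  { f          = f
  ; injective  = injective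
  ; into-ends  = λ u → Data.Sum.map (λ (y , r) → y , to r) (λ (y , r) → y , to r) (into-ends u)
  ; onto-ends₁ = λ x y r → onto-ends₁ x y (from r)
  ; onto-ends₂ = λ x y r → onto-ends₂ x y (from r)
  ; adjacency  = λ u v → mk⇔ (to ∘ Equivalence.to (adjacency u v))
                             (Equivalence.from (adjacency u v) ∘ from)
  }
  where
  open QnIsoToInduced iso
  to : ∀ {x y} → R x y → R′ x y
  to {x} {y} = Equivalence.to (R⇔R′ x y)
  from : ∀ {x y} → R′ x y → R x y
  from {x} {y} = Equivalence.from (R⇔R′ x y)

indicator : ∀ {n} → Subset n → Fin n → Bool
indicator J i = does (i ∈? J)

MixedEdges⇔H₁ : ∀ {n} (J : Subset n) x y → MixedEdges (indicator J) x y ⇔ H₁ J x y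
MixedEdges⇔H₁ {n} J x y = mk⇔ fromMixed toMixed
  where
  c : Fin n → Bool
  c = indicator J
  toMixed : H₁ J x y → MixedEdges c x y
  toMixed (inj₁ (i , i∉J , y≡)) = i , trans y≡ (sym (flipWith-false c i x (dec-false (i ∈? J) i∉J)))
  toMixed (inj₂ (j , j∈J , y≡)) = j , trans y≡ (sym (flipWith-true c j x (dec-true (j ∈? J) j∈J)))
  fromMixed : MixedEdges c x y → H₁ J x y
  fromMixed (i , y≡) with i ∈? J
  ... | yes i∈J = inj₂ (i , i∈J , y≡)
  ... | no  i∉J = inj₁ (i , i∉J , y≡)

-- The choice at dimension 1 is immaterial (E_{≤ 1} = E_1); false makes it E_1 on the nose.
complementOf : ∀ {n} → Subset n → Fin n → Bool
complementOf J zero    = false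
complementOf J (suc i) = not (does (suc i ∈? J))

MixedEdges⇔H₂ : ∀ {n} (J : Subset n) x y → MixedEdges (complementOf J) x y ⇔ H₂ J x y
MixedEdges⇔H₂ {n} J x y = mk⇔ fromMixed toMixed
  where
  c : Fin n → Bool
  c = complementOf J
  toMixed : H₂ J x y → MixedEdges c x y
  toMixed (inj₁ (zero , _ , y≡)) = zero , y≡
  toMixed (inj₂ (inj₁ (zero , _ , y≡))) = zero , y≡
  toMixed (inj₂ (inj₁ (suc j , j∈J , y≡))) =
    suc j , trans y≡ (sym (flipWith-false c (suc j) x (cong not (dec-true (suc j ∈? J) j∈J))))
  toMixed (inj₂ (inj₂ (zero , i≢0 , _ , _))) = ⊥-elim (i≢0 refl)
  toMixed (inj₂ (inj₂ (suc i , _ , i∉J , y≡))) =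
    suc i , trans y≡ (sym (flipWith-true c (suc i) x (cong not (dec-false (suc i ∈? J) i∉J))))
  fromMixed : MixedEdges c x y → H₂ J x y
  fromMixed (zero , y≡) = inj₁ (zero , refl , y≡)
  fromMixed (suc i , y≡) with suc i ∈? J
  ... | yes i∈J = inj₂ (inj₁ (suc i , i∈J , y≡))
  ... | no  i∉J = inj₂ (inj₂ (suc i , (λ ()) , i∉J , y≡))

theorem3p3 : (n : ℕ) → 2 ≤ n → (k : ℕ) → 1 ≤ k → k ≤ n ∸ 1 →
    (J : Subset n) → (∀ (j : Fin n) → j ∈ J → 1 ≤ toℕ j) → ∣ J ∣ ≡ k →
    QnIsoToInduced n (H₁ J) × QnIsoToInduced n (H₂ J)
theorem3p3 (suc n) _ _ _ _ J _ _ =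
    QnIsoToInduced-resp-⇔ (MixedEdges⇔H₁ J) (MixedEdges-QnIso _)
  , QnIsoToInduced-resp-⇔ (MixedEdges⇔H₂ J) (MixedEdges-QnIso _)
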